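{- Let $G$ be a cobweb with presentation $(C,I)$ and let $\omega$ be a wedge-selection for $(G,C,I)$. Let $u, v \in I$ be distinct. If $u$ attaches to $\omega(v)$, then exactly one of the following holds: $\omega(u)$ improves $\omega(v)$, or $v$ attaches to $\omega(u)$.
   Context: All graphs are finite and simple. A graph $G$ is a cobweb with presentation $(C,I)$ if: $C$ is an induced cycle of $G$ and $I := V(G)\setminus V(C)$ is a non-empty independent set; $G$ has minimum degree at least $2$; and $N(u)\not\subseteq N(v)$ for all distinct $u,v\in I$. A wedge of $(G,C,I)$ is a (not necessarily induced) cycle $W$ in $G$ containing exactly one vertex $v$ of $I$ (its anchor) and exactly two vertices of $N(v)$; so $W-v$ is a subpath of $C$ whose endpoints are the two neighbours of $v$ in $W$. A vertex $u\in I\setminus V(W)$ attaches to $W$ if $N(u)\subseteq V(W)$. A wedge-selection for $(G,C,I)$ is a map $\omega$ assigning to each $v\in I$ a wedge $\omega(v)$ anchored in $v$. For $u,v\in I$, $\omega(u)$ improves $\omega(v)$ if $\omega(u)-u$ is a proper subgraph of $\omega(v)-v$. -}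

module Defs where

open import Data.Nat using (ℕ; _≤_)
open import Data.Fin using (Fin)
open import Data.Bool using (Bool; true; false)
open import Data.List using (List; []; _∷_; _++_; [_]; zip; length)
open import Data.List.Membership.Propositional using (_∈_; _∉_)
open import Data.List.Relation.Unary.All using (All)
open import Data.List.Relation.Unary.Unique.Propositional using (Unique)
open import Data.Product using (Σ; ∃; _×_; _,_)
open import Data.Sum using (_⊎_)
open import Relation.Nullary using (¬_)
open import Relation.Binary.PropositionalEquality using (_≡_; _≢_)

record Graph (n : ℕ) : Set where
  field
    adj    : Fin n → Fin n → Bool
    sym    : ∀ x y → adj x y ≡ adj y x
    irrefl : ∀ x → adj x x ≡ false

module _ {n : ℕ} where

  Adj : Graph n → Fin n → Fin n → Set
  Adj G x y = Graph.adj G x y ≡ true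

  pairs : List (Fin n) → List (Fin n × Fin n)
  pairs []       = []
  pairs (x ∷ xs) = zip (x ∷ xs) (xs ++ [ x ])

  EdgeOf : List (Fin n) → Fin n → Fin n → Set
  EdgeOf W x y = ((x , y) ∈ pairs W) ⊎ ((y , x) ∈ pairs W)

  AdjPair : Graph n → Fin n × Fin n → Set
  AdjPair G (x , y) = Adj G x y

  IsCycle : Graph n → List (Fin n) → Set
  IsCycle G W = Unique W × (3 ≤ length W) × All (AdjPair G) (pairs W)

  IsInducedCycle : Graph n → List (Fin n) → Set
  IsInducedCycle G C =
    IsCycle G C × (∀ x y → x ∈ C → y ∈ C → Adj G x y → EdgeOf C x y)

  -- G is a cobweb with presentation (C, I), where I = V(G) \ V(C)
  -- (membership in I is  x ∉ C).
  IsCobweb : Graph n → List (Fin n) → Set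
  IsCobweb G C =
    IsInducedCycle G C
    × (∀ x y → x ∉ C → y ∉ C → ¬ Adj G x y)
    × (∃ λ x → x ∉ C)
    × (∀ x → Σ (Fin n) λ y → Σ (Fin n) λ z →
          y ≢ z × Adj G x y × Adj G x z)
    × (∀ u v → u ∉ C → v ∉ C → u ≢ v →
          ∃ λ w → Adj G u w × ¬ Adj G v w)

  IsWedge : Graph n → List (Fin n) → Fin n → List (Fin n) → Set
  IsWedge G C v W =
    IsCycle G W × v ∈ W
    × (∀ x → x ∈ W → x ∉ C → x ≡ v)
    × (Σ (Fin n) λ a → Σ (Fin n) λ b →
         a ≢ b × a ∈ W × b ∈ W × Adj G v a × Adj G v b
         × (∀ x → x ∈ W → Adj G v x → x ≡ a ⊎ x ≡ b))

  Attaches : Graph n → Fin n → List (Fin n) → Set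
  Attaches G u W = u ∉ W × (∀ x → Adj G u x → x ∈ W)

  -- ω is a wedge-selection: ω v is a wedge anchored in v for every v ∈ I
  -- (values of ω on vertices of C are irrelevant).
  WedgeSelection : Graph n → List (Fin n) → (Fin n → List (Fin n)) → Set
  WedgeSelection G C ω = ∀ v → v ∉ C → IsWedge G C v (ω v)

  -- The graph W − v: vertices and edges.
  VDel : List (Fin n) → Fin n → Fin n → Set
  VDel W v x = x ∈ W × x ≢ v

  EDel : List (Fin n) → Fin n → Fin n → Fin n → Set
  EDel W v x y = EdgeOf W x y × x ≢ v × y ≢ v

  SubDel : List (Fin n) → Fin n → List (Fin n) → Fin n → Set
  SubDel W u W' v =
    (∀ x → VDel W u x → VDel W' v x) × (∀ x y → EDel W u x y → EDel W' v x y)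

  ProperSubDel : List (Fin n) → Fin n → List (Fin n) → Fin n → Set
  ProperSubDel W u W' v = SubDel W u W' v × ¬ SubDel W' v W u

  Improves : (Fin n → List (Fin n)) → Fin n → Fin n → Set
  Improves ω u v = ProperSubDel (ω u) u (ω v) v

ExactlyOne : Set → Set → Set
ExactlyOne A B = (A ⊎ B) × ¬ (A × B)

{-# OPTIONS --safe #-}
module Submission where

open import Defs
open import Data.Nat using (ℕ; zero; suc; _<_; _≤_; z≤n; s≤s)
open import Data.Nat.Properties
  using (≤-refl; ≤-trans; <⇒≤; ≤-pred; <-trans; <-≤-trans; <-irrefl; ≤∧≢⇒<;
         m≤n⇒m<n∨m≡n; m≤n⇒m≤1+n; n≤0⇒n≡0; +-comm)
open import Data.Fin using (Fin) renaming (_≟_ to _≟ᶠ_)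
import Data.Fin.Properties as Fin
open import Data.Bool using (true) renaming (_≟_ to _≟ᵇ_)
open import Data.List using (List; []; _∷_; _++_; [_]; zip; length)
open import Data.List.Properties using (++-assoc; ++-identityʳ; length-++)
open import Data.List.Membership.Propositional using (_∈_; _∉_)
open import Data.List.Membership.Propositional.Properties using (∈-∃++)
import Data.List.Membership.DecPropositional as DecMembership
open import Data.List.Relation.Unary.All using () renaming (lookup to All-lookup)
open import Data.List.Relation.Unary.Any using (here; there)
open import Data.List.Relation.Unary.Unique.Propositional using (Unique; _∷_)
open import Data.List.Relation.Binary.Permutation.Propositional
  using (_↭_; ↭-sym; ↭-reflexive; ↭⇒↭ₛ; module PermutationReasoning)
open import Data.List.Relation.Binary.Permutation.Propositional.Properties
  using (++-comm; ∈-resp-↭)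
import Data.List.Relation.Binary.Permutation.Setoid.Properties as SetoidPermutation
open import Data.Product using (∃-syntax; _×_; _,_; proj₁; proj₂; swap)
import Data.Product.Properties as Product
open import Data.Sum using (_⊎_; inj₁; inj₂) renaming (map to ⊎-map)
open import Data.Empty using (⊥; ⊥-elim)
open import Function using (_∘_)
open import Relation.Nullary using (¬_; Dec; yes; no)
open import Relation.Nullary.Decidable using (_×-dec_; _→-dec_; _⊎-dec_; ¬?; decidable-stable)
open import Relation.Unary using (Decidable)
open import Relation.Binary.PropositionalEquality
  using (_≡_; _≢_; refl; sym; trans; cong; subst; setoid)

-- For X in I, ω(X) − X is a path of C whose two ends are the neighbours of X on ω(X).
--
-- If ω(u) − u ⊆ ω(v) − v, take z adjacent to v but not to u (the cobweb condition).
-- Were v attached to ω(u), z would lie on ω(u) − u without being an end of it, so its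
-- two neighbours on that path, together with v, would be three neighbours of z on the
-- cycle ω(v). The same argument with u and v exchanged shows the inclusion is proper.
--
-- Otherwise some neighbour y of v is missed by ω(u); cutting C open at y turns both
-- paths into intervals of positions. The ends of ω(u) − u are neighbours of u, hence
-- lie on ω(v) − v, and since v has only two neighbours on ω(v), the path ω(v) − v
-- cannot wrap around y. So it is an interval containing both ends of ω(u) − u, hence
-- all of ω(u) − u, contradicting the failed inclusion.

Flips : (ℕ → Set) → ℕ → Set
Flips P k = (P k × ¬ P (suc k)) ⊎ (¬ P k × P (suc k))

¬Flips-both : ∀ {P k} → Flips P k → P k → P (suc k) → ⊥
¬Flips-both (inj₁ (_ , ¬pk′)) _ pk′ = ¬pk′ pk′
¬Flips-both (inj₂ (¬pk , _)) pk _ = ¬pk pk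

falls-between : {P : ℕ → Set} → Decidable P → ∀ {a b} → a ≤ b → P a → ¬ P b →
  ∃[ k ] a ≤ k × k < b × P k × ¬ P (suc k)
falls-between {P} P? {b = zero} a≤0 pa ¬pb = ⊥-elim (¬pb (subst P (n≤0⇒n≡0 a≤0) pa))
falls-between P? {b = suc b} a≤b pa ¬pb with m≤n⇒m<n∨m≡n a≤b
... | inj₂ refl = ⊥-elim (¬pb pa)
... | inj₁ a<sb with P? b
...   | yes pb = b , ≤-pred a<sb , ≤-refl , pb , ¬pb
...   | no ¬pb′ =
  let (k , a≤k , k<b , pk , ¬pk′) = falls-between P? (≤-pred a<sb) pa ¬pb′
  in k , a≤k , m≤n⇒m≤1+n k<b , pk , ¬pk′

rises-between : {P : ℕ → Set} → Decidable P → ∀ {a b} → a ≤ b → ¬ P a → P b →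
  ∃[ k ] a ≤ k × k < b × ¬ P k × P (suc k)
rises-between P? a≤b ¬pa pb =
  let (k , a≤k , k<b , ¬pk , ¬¬pk′) = falls-between (¬? ∘ P?) a≤b ¬pa (λ ¬pb → ¬pb pb)
  in k , a≤k , k<b , ¬pk , decidable-stable (P? _) ¬¬pk′

-- V marks the positions where g may start or stop holding; at most two such positions
-- force g to hold on an interval of 0 … last.
module Interval (last : ℕ) {g V : ℕ → Set} (g? : Decidable g)
  (flip⇒V : ∀ {k} → k < last → Flips g k → V (suc k))
  (start⇒V : g 0 → V 0)
  (V-atMost2 : ∀ {i j k} → i < j → j < k → k ≤ last → V i → V j → V k → ⊥) where

  V-before : ∀ {i} → i ≤ last → g i → ∃[ j ] j ≤ i × V j
  V-before i≤last gi with g? 0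
  ... | yes g0 = 0 , z≤n , start⇒V g0
  ... | no ¬g0 =
    let (k , _ , k<i , ¬gk , gk′) = rises-between g? z≤n ¬g0 gi
    in suc k , k<i , flip⇒V (<-≤-trans k<i i≤last) (inj₂ (¬gk , gk′))

  convex : ∀ {i e i′} → i < e → e < i′ → i′ ≤ last → g i → g i′ → g e
  convex {e = e} i<e e<i′ i′≤last gi gi′ = decidable-stable (g? e) λ ¬ge →
    let (k , i≤k , k<e , gk , ¬gk′) = falls-between g? (<⇒≤ i<e) gi ¬ge
        (l , e≤l , l<i′ , ¬gl , gl′) = rises-between g? (<⇒≤ e<i′) ¬ge gi′
        (j , j≤i , Vj) = V-before (<⇒≤ (<-trans i<e (<-≤-trans e<i′ i′≤last))) gi
        k<l = <-≤-trans k<e e≤l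
        l<last = <-≤-trans l<i′ i′≤last
    in V-atMost2 (s≤s (≤-trans j≤i i≤k)) (s≤s k<l) l<last
         Vj (flip⇒V (<-trans k<l l<last) (inj₁ (gk , ¬gk′))) (flip⇒V l<last (inj₂ (¬gl , gl′)))

  private
    holds-left : ∀ {k e} → k < e → ¬ g e → g k ⊎ g (suc k) → ∃[ i ] i < e × g i
    holds-left k<e _ (inj₁ gk) = _ , k<e , gk
    holds-left k<e ¬ge (inj₂ gk′) = _ , ≤∧≢⇒< k<e (λ { refl → ¬ge gk′ }) , gk′

    holds-right : ∀ {e k} → e ≤ k → k < last → ¬ g e → g k ⊎ g (suc k) →
      ∃[ i ] e < i × i ≤ last × g i
    holds-right e≤k k<last ¬ge (inj₁ gk) =
      _ , ≤∧≢⇒< e≤k (λ { refl → ¬ge gk }) , <⇒≤ k<last , gk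
    holds-right e≤k k<last _ (inj₂ gk′) = _ , s≤s e≤k , k<last , gk′

  contained : {f : ℕ → Set} → Decidable f → ¬ f 0 → ¬ f last →
    (∀ {k} → k < last → Flips f k → g k ⊎ g (suc k)) →
    ∀ {e} → e ≤ last → f e → g e
  contained f? ¬f0 ¬f-last flip⇒touch {e} e≤last fe = decidable-stable (g? e) λ ¬ge →
    let (k , _ , k<e , ¬fk , fk′) = rises-between f? z≤n ¬f0 fe
        (l , e≤l , l<last , fl , ¬fl′) = falls-between f? e≤last fe ¬f-last
        (i , i<e , gi) =
          holds-left k<e ¬ge (flip⇒touch (<-≤-trans k<e e≤last) (inj₂ (¬fk , fk′)))
        (i′ , e<i′ , i′≤last , gi′) =
          holds-right e≤l l<last ¬ge (flip⇒touch l<last (inj₁ (fl , ¬fl′)))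
    in ¬ge (convex i<e e<i′ i′≤last gi gi′)

module _ {X : Set} where

  steps : List X → List (X × X)
  steps (x ∷ y ∷ zs) = (x , y) ∷ steps (y ∷ zs)
  steps _            = []

  zip-steps : ∀ x xs z → zip (x ∷ xs) (xs ++ [ z ]) ≡ steps (x ∷ xs ++ [ z ])
  zip-steps x []       z = refl
  zip-steps x (y ∷ ys) z = cong ((x , y) ∷_) (zip-steps y ys z)

  steps-++ : ∀ xs z ys → steps (xs ++ z ∷ ys) ≡ steps (xs ++ [ z ]) ++ steps (z ∷ ys)
  steps-++ []           z ys = refl
  steps-++ (x ∷ [])     z ys = refl
  steps-++ (x ∷ x′ ∷ xs) z ys = cong ((x , x′) ∷_) (steps-++ (x′ ∷ xs) z ys)

  nth : X → List X → ℕ → X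
  nth d []       _       = d
  nth d (x ∷ xs) zero    = x
  nth d (x ∷ xs) (suc i) = nth d xs i

  steps⇒nth : ∀ d xs {a b} → (a , b) ∈ steps xs →
    ∃[ j ] suc j < length xs × nth d xs j ≡ a × nth d xs (suc j) ≡ b
  steps⇒nth d (x ∷ y ∷ zs) (here refl) = 0 , s≤s (s≤s z≤n) , refl , refl
  steps⇒nth d (x ∷ y ∷ zs) (there p) =
    let (j , j<len , eq₁ , eq₂) = steps⇒nth d (y ∷ zs) p in suc j , s≤s j<len , eq₁ , eq₂

  nth⇒steps : ∀ d xs {j} → suc j < length xs → (nth d xs j , nth d xs (suc j)) ∈ steps xs
  nth⇒steps d (x ∷ y ∷ zs) {zero}  _             = here refl
  nth⇒steps d (x ∷ y ∷ zs) {suc j} (s≤s j<len) = there (nth⇒steps d (y ∷ zs) j<len)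
  nth⇒steps d (x ∷ [])     {j}     (s≤s ())

  nth-∈ : ∀ d xs {j} → j < length xs → nth d xs j ∈ xs
  nth-∈ d (x ∷ xs) {zero}  _             = here refl
  nth-∈ d (x ∷ xs) {suc j} (s≤s j<len) = there (nth-∈ d xs j<len)

  ∈⇒nth : ∀ d xs {x} → x ∈ xs → ∃[ j ] j < length xs × nth d xs j ≡ x
  ∈⇒nth d (x ∷ xs) (here refl) = 0 , s≤s z≤n , refl
  ∈⇒nth d (x ∷ xs) (there p) = let (j , j<len , eq) = ∈⇒nth d xs p in suc j , s≤s j<len , eq

  nth-++ˡ : ∀ d xs ys {j} → j < length xs → nth d (xs ++ ys) j ≡ nth d xs j
  nth-++ˡ d (x ∷ xs) ys {zero}  _             = refl
  nth-++ˡ d (x ∷ xs) ys {suc j} (s≤s j<len) = nth-++ˡ d xs ys j<len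

  nth-length : ∀ d xs z ys → nth d (xs ++ z ∷ ys) (length xs) ≡ z
  nth-length d []       z ys = refl
  nth-length d (x ∷ xs) z ys = nth-length d xs z ys

  nth-injective : ∀ d xs → Unique xs → ∀ {i j} → i < length xs → j < length xs →
    nth d xs i ≡ nth d xs j → i ≡ j
  nth-injective d (x ∷ xs) _ {zero} {zero} _ _ _ = refl
  nth-injective d (x ∷ xs) (x∉ ∷ _) {zero} {suc j} _ (s≤s j<len) eq =
    ⊥-elim (All-lookup x∉ (nth-∈ d xs j<len) eq)
  nth-injective d (x ∷ xs) (x∉ ∷ _) {suc i} {zero} (s≤s i<len) _ eq =
    ⊥-elim (All-lookup x∉ (nth-∈ d xs i<len) (sym eq))
  nth-injective d (x ∷ xs) (_ ∷ uniq) {suc i} {suc j} (s≤s i<len) (s≤s j<len) eq =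
    cong suc (nth-injective d xs uniq i<len j<len eq)

three-among-two : {A : Set} {a b x y z : A} →
  x ≡ a ⊎ x ≡ b → y ≡ a ⊎ y ≡ b → z ≡ a ⊎ z ≡ b → x ≢ y → x ≢ z → y ≢ z → ⊥
three-among-two (inj₁ refl) (inj₁ refl) _           x≢y _   _   = x≢y refl
three-among-two (inj₂ refl) (inj₂ refl) _           x≢y _   _   = x≢y refl
three-among-two (inj₁ refl) (inj₂ refl) (inj₁ refl) _   x≢z _   = x≢z refl
three-among-two (inj₁ refl) (inj₂ refl) (inj₂ refl) _   _   y≢z = y≢z refl
three-among-two (inj₂ refl) (inj₁ refl) (inj₁ refl) _   _   y≢z = y≢z refl
three-among-two (inj₂ refl) (inj₁ refl) (inj₂ refl) _   x≢z _   = x≢z refl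

module _ {n : ℕ} where

  pairs≡steps : ∀ (x : Fin n) xs → pairs (x ∷ xs) ≡ steps (x ∷ xs ++ [ x ])
  pairs≡steps x xs = zip-steps x xs x

  pairs-rotate : ∀ (A B : List (Fin n)) y → pairs (A ++ y ∷ B) ↭ pairs (y ∷ B ++ A)
  pairs-rotate []      B y = ↭-reflexive (cong (λ zs → pairs (y ∷ zs)) (sym (++-identityʳ B)))
  pairs-rotate (x ∷ A) B y = begin
    pairs (x ∷ A ++ y ∷ B)                          ≡⟨ pairs≡steps x (A ++ y ∷ B) ⟩
    steps (x ∷ (A ++ y ∷ B) ++ [ x ])                ≡⟨ cong (λ zs → steps (x ∷ zs)) (++-assoc A (y ∷ B) [ x ]) ⟩
    steps ((x ∷ A) ++ y ∷ B ++ [ x ])                ≡⟨ steps-++ (x ∷ A) y (B ++ [ x ]) ⟩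
    steps (x ∷ A ++ [ y ]) ++ steps (y ∷ B ++ [ x ]) ↭⟨ ++-comm (steps (x ∷ A ++ [ y ])) _ ⟩
    steps (y ∷ B ++ [ x ]) ++ steps (x ∷ A ++ [ y ]) ≡⟨ steps-++ (y ∷ B) x (A ++ [ y ]) ⟨
    steps ((y ∷ B) ++ x ∷ A ++ [ y ])                ≡⟨ cong (λ zs → steps (y ∷ zs)) (++-assoc B (x ∷ A) [ y ]) ⟨
    steps (y ∷ (B ++ x ∷ A) ++ [ y ])                ≡⟨ pairs≡steps y (B ++ x ∷ A) ⟨
    pairs (y ∷ B ++ x ∷ A)                          ∎
    where open PermutationReasoning

  EdgeOf-rotate : ∀ (A B : List (Fin n)) y {a b} →
    EdgeOf (A ++ y ∷ B) a b → EdgeOf (y ∷ B ++ A) a b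
  EdgeOf-rotate A B y = ⊎-map (∈-resp-↭ (pairs-rotate A B y)) (∈-resp-↭ (pairs-rotate A B y))

  EdgeOf-sym : ∀ (W : List (Fin n)) {x y} → EdgeOf W x y → EdgeOf W y x
  EdgeOf-sym W (inj₁ p) = inj₂ p
  EdgeOf-sym W (inj₂ p) = inj₁ p

  EDel-sym : ∀ (W : List (Fin n)) {X x y} → EDel W X x y → EDel W X y x
  EDel-sym W (e , x≢X , y≢X) = EdgeOf-sym W e , y≢X , x≢X

  open DecMembership (_≟ᶠ_ {n}) using (_∈?_)
  open DecMembership (Product.≡-dec (_≟ᶠ_ {n}) (_≟ᶠ_ {n})) using () renaming (_∈?_ to _∈²?_)

  EdgeOf? : ∀ W x y → Dec (EdgeOf W x y)
  EdgeOf? W x y = ((x , y) ∈²? pairs W) ⊎-dec ((y , x) ∈²? pairs W)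

  EDel? : ∀ W X x y → Dec (EDel W X x y)
  EDel? W X x y = EdgeOf? W x y ×-dec ¬? (x ≟ᶠ X) ×-dec ¬? (y ≟ᶠ X)

  VDel? : ∀ W X x → Dec (VDel W X x)
  VDel? W X x = (x ∈? W) ×-dec ¬? (x ≟ᶠ X)

  SubDel? : ∀ W X W′ Y → Dec (SubDel W X W′ Y)
  SubDel? W X W′ Y =
    Fin.all? (λ x → VDel? W X x →-dec VDel? W′ Y x)
    ×-dec Fin.all? (λ x → Fin.all? (λ y → EDel? W X x y →-dec EDel? W′ Y x y))

-- Vertex j is the j-th vertex met when walking once around the cycle h ∷ t from h;
-- the walk takes len steps and vertex len is h again.
module Walk {n : ℕ} (h : Fin n) (t : List (Fin n)) where

  len : ℕ
  len = suc (length t)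

  closed : List (Fin n)
  closed = h ∷ t ++ [ h ]

  vertex : ℕ → Fin n
  vertex = nth h closed

  length-closed : length closed ≡ suc len
  length-closed = cong suc (trans (length-++ t) (+-comm (length t) 1))

  vertex≡nth : ∀ {j} → j < len → vertex j ≡ nth h (h ∷ t) j
  vertex≡nth = nth-++ˡ h (h ∷ t) [ h ]

  vertex-len : vertex len ≡ h
  vertex-len = nth-length h (h ∷ t) h []

  edge⇒position : ∀ {a b} → (a , b) ∈ pairs (h ∷ t) →
    ∃[ j ] j < len × vertex j ≡ a × vertex (suc j) ≡ b
  edge⇒position p =
    let (j , sj<len , eq₁ , eq₂) = steps⇒nth h closed (subst (_ ∈_) (pairs≡steps h t) p)
    in j , ≤-pred (subst (suc j <_) length-closed sj<len) , eq₁ , eq₂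

  position⇒edge : ∀ {j} → j < len → (vertex j , vertex (suc j)) ∈ pairs (h ∷ t)
  position⇒edge {j} j<len = subst ((vertex j , vertex (suc j)) ∈_) (sym (pairs≡steps h t))
    (nth⇒steps h closed (subst (suc j <_) (sym length-closed) (s≤s j<len)))

  vertex-∈ : ∀ {j} → j ≤ len → vertex j ∈ h ∷ t
  vertex-∈ j≤len with m≤n⇒m<n∨m≡n j≤len
  ... | inj₁ j<len = subst (_∈ h ∷ t) (sym (vertex≡nth j<len)) (nth-∈ h (h ∷ t) j<len)
  ... | inj₂ refl  = subst (_∈ h ∷ t) (sym vertex-len) (here refl)

  ∈⇒position : ∀ {x} → x ∈ h ∷ t → ∃[ j ] j < len × vertex j ≡ x
  ∈⇒position x∈ =
    let (j , j<len , eq) = ∈⇒nth h (h ∷ t) x∈ in j , j<len , trans (vertex≡nth j<len) eq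

  vertex-injective : Unique (h ∷ t) → ∀ {i j} → i < len → j < len → vertex i ≡ vertex j → i ≡ j
  vertex-injective uniq i<len j<len eq = nth-injective h (h ∷ t) uniq i<len j<len
    (trans (sym (vertex≡nth i<len)) (trans eq (vertex≡nth j<len)))

  ¬3≤2 : ¬ 3 ≤ 2
  ¬3≤2 (s≤s (s≤s ()))

  previous : ℕ → ℕ
  previous zero    = length t
  previous (suc k) = k

  edge-to-next : ∀ {r} → r < len → EdgeOf (h ∷ t) (vertex r) (vertex (suc r))
  edge-to-next r<len = inj₁ (position⇒edge r<len)

  edge-to-previous : ∀ {r} → r < len → EdgeOf (h ∷ t) (vertex r) (vertex (previous r))
  edge-to-previous {zero}  _ =
    inj₂ (subst (λ z → (vertex (length t) , z) ∈ pairs (h ∷ t)) vertex-len (position⇒edge ≤-refl))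
  edge-to-previous {suc k} k<len = inj₂ (position⇒edge (<⇒≤ k<len))

  edge-from-vertex : Unique (h ∷ t) → ∀ {r p} → r < len → EdgeOf (h ∷ t) (vertex r) p →
    p ≡ vertex (suc r) ⊎ p ≡ vertex (previous r)
  edge-from-vertex uniq {r} r<len (inj₁ e) with edge⇒position e
  ... | j , j<len , eq₁ , eq₂ with vertex-injective uniq j<len r<len eq₁
  ... | refl = inj₁ (sym eq₂)
  edge-from-vertex uniq {r} r<len (inj₂ e) with edge⇒position e
  ... | j , j<len , eq₁ , eq₂ with m≤n⇒m<n∨m≡n j<len
  ... | inj₁ sj<len with vertex-injective uniq sj<len r<len eq₂
  ...   | refl = inj₂ (sym eq₁)
  edge-from-vertex uniq {r} r<len (inj₂ e) | j , j<len , eq₁ , eq₂ | inj₂ refl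
    with vertex-injective uniq (s≤s z≤n) r<len (trans (sym vertex-len) eq₂)
  ...   | refl = inj₂ (sym eq₁)

  next≢previous : Unique (h ∷ t) → 3 ≤ len → ∀ {r} → r < len → vertex (suc r) ≢ vertex (previous r)
  next≢previous uniq 3≤len {zero} _ eq = ¬3≤2 (subst (λ l → 3 ≤ suc l) (sym 1≡last) 3≤len)
    where
    1≡last : 1 ≡ length t
    1≡last = vertex-injective uniq (≤-trans (s≤s (s≤s z≤n)) 3≤len) ≤-refl eq
  next≢previous uniq 3≤len {suc k} k<len eq with m≤n⇒m<n∨m≡n k<len
  ... | inj₁ ssk<len with vertex-injective uniq ssk<len (<-trans ≤-refl k<len) eq
  ...   | ()
  next≢previous uniq 3≤len {suc k} k<len eq | inj₂ ssk≡len =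
    ¬3≤2 (subst (λ l → 3 ≤ suc (suc l)) (sym 0≡k) (subst (3 ≤_) (sym ssk≡len) 3≤len))
    where
    0≡k : 0 ≡ k
    0≡k = vertex-injective uniq (s≤s z≤n) (<-trans ≤-refl k<len)
      (trans (sym vertex-len) (subst (λ j → vertex j ≡ vertex k) ssk≡len eq))

module _ {n : ℕ} where

  pairs-∈ : ∀ (W : List (Fin n)) {a b} → (a , b) ∈ pairs W → a ∈ W × b ∈ W
  pairs-∈ (h ∷ t) p with Walk.edge⇒position h t p
  ... | j , j<len , refl , refl = Walk.vertex-∈ h t (<⇒≤ j<len) , Walk.vertex-∈ h t j<len

  EdgeOf-∈ : ∀ (W : List (Fin n)) {a b} → EdgeOf W a b → a ∈ W × b ∈ W
  EdgeOf-∈ W (inj₁ p) = pairs-∈ W p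
  EdgeOf-∈ W (inj₂ p) = swap (pairs-∈ W p)

  record TwoNeighbours (W : List (Fin n)) (x : Fin n) : Set where
    field
      next prev : Fin n
      next≢prev : next ≢ prev
      to-next   : EdgeOf W x next
      to-prev   : EdgeOf W x prev
      only      : ∀ {p} → EdgeOf W x p → p ≡ next ⊎ p ≡ prev

  cycle-neighbours : ∀ {W : List (Fin n)} → Unique W → 3 ≤ length W → ∀ {x} → x ∈ W →
    TwoNeighbours W x
  cycle-neighbours {h ∷ t} uniq 3≤len x∈ with Walk.∈⇒position h t x∈
  ... | r , r<len , refl = record
    { next      = vertex (suc r)
    ; prev      = vertex (previous r)
    ; next≢prev = next≢previous uniq 3≤len r<len
    ; to-next   = edge-to-next r<len
    ; to-prev   = edge-to-previous r<len
    ; only      = edge-from-vertex uniq r<len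
    }
    where open Walk h t

open TwoNeighbours

module Cobweb {n : ℕ} (G : Graph n) (C : List (Fin n)) (cob : IsCobweb G C)
  (ω : Fin n → List (Fin n)) (ws : WedgeSelection G C ω) where

  open DecMembership (_≟ᶠ_ {n}) using (_∈?_)

  C-unique : Unique C
  C-unique = proj₁ (proj₁ (proj₁ cob))

  C-induced : ∀ x y → x ∈ C → y ∈ C → Adj G x y → EdgeOf C x y
  C-induced = proj₂ (proj₁ cob)

  I-independent : ∀ x y → x ∉ C → y ∉ C → ¬ Adj G x y
  I-independent = proj₁ (proj₂ cob)

  I-incomparable : ∀ x y → x ∉ C → y ∉ C → x ≢ y → ∃[ z ] Adj G x z × ¬ Adj G y z
  I-incomparable = proj₂ (proj₂ (proj₂ (proj₂ cob)))

  Adj-sym : ∀ {x y} → Adj G x y → Adj G y x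
  Adj-sym {x} {y} = trans (Graph.sym G y x)

  Adj? : ∀ x y → Dec (Adj G x y)
  Adj? x y = Graph.adj G x y ≟ᵇ true

  neighbour∈C : ∀ {x z} → x ∉ C → Adj G x z → z ∈ C
  neighbour∈C {x} {z} x∉ xz = decidable-stable (z ∈? C) (λ z∉ → I-independent x z x∉ z∉ xz)

  ∉C⇒≢ : ∀ {x z} → z ∉ C → x ∈ C → x ≢ z
  ∉C⇒≢ z∉ x∈ refl = z∉ x∈

  module Wedge {X : Fin n} (X∉ : X ∉ C) where

    unique : Unique (ω X)
    unique = proj₁ (proj₁ (ws X X∉))

    anchor∈ : X ∈ ω X
    anchor∈ = proj₁ (proj₂ (ws X X∉))

    only-anchor : ∀ x → x ∈ ω X → x ∉ C → x ≡ X
    only-anchor = proj₁ (proj₂ (proj₂ (ws X X∉)))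

    edge⇒Adj : ∀ {x y} → EdgeOf (ω X) x y → Adj G x y
    edge⇒Adj (inj₁ p) = All-lookup (proj₂ (proj₂ (proj₁ (ws X X∉)))) p
    edge⇒Adj (inj₂ p) = Adj-sym (edge⇒Adj (inj₁ p))

    neighbours : ∀ {x} → x ∈ ω X → TwoNeighbours (ω X) x
    neighbours = cycle-neighbours unique (proj₁ (proj₂ (proj₁ (ws X X∉))))

    ¬three-anchor-neighbours : ∀ {x y z} → x ∈ ω X → y ∈ ω X → z ∈ ω X →
      Adj G X x → Adj G X y → Adj G X z → x ≢ y → x ≢ z → y ≢ z → ⊥
    ¬three-anchor-neighbours x∈ y∈ z∈ Xx Xy Xz =
      let (_ , _ , _ , _ , _ , _ , _ , among) = proj₂ (proj₂ (proj₂ (ws X X∉)))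
      in three-among-two (among _ x∈ Xx) (among _ y∈ Xy) (among _ z∈ Xz)

    VDel⇒∈C : ∀ {x} → VDel (ω X) X x → x ∈ C
    VDel⇒∈C {x} (x∈ , x≢X) = decidable-stable (x ∈? C) (x≢X ∘ only-anchor x x∈)

    EDel⇒EdgeOfC : ∀ {x y} → EDel (ω X) X x y → EdgeOf C x y
    EDel⇒EdgeOfC {x} {y} (e , x≢X , y≢X) =
      let (x∈ , y∈) = EdgeOf-∈ (ω X) e
      in C-induced x y (VDel⇒∈C (x∈ , x≢X)) (VDel⇒∈C (y∈ , y≢X)) (edge⇒Adj e)

    VDel⇒EDel : ∀ {x} → VDel (ω X) X x → ∃[ p ] EDel (ω X) X x p
    VDel⇒EDel (x∈ , x≢X) with neighbours x∈
    ... | nb with next nb ≟ᶠ X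
    ...   | yes refl = prev nb , to-prev nb , x≢X , λ prev≡X → next≢prev nb (sym prev≡X)
    ...   | no next≢X = next nb , to-next nb , x≢X , next≢X

    two-EDel-if-¬Adj : ∀ {x} → VDel (ω X) X x → ¬ Adj G X x →
      ∃[ p ] ∃[ q ] p ≢ q × EDel (ω X) X x p × EDel (ω X) X x q
    two-EDel-if-¬Adj {x} (x∈ , x≢X) ¬Xx =
      let nb = neighbours x∈
      in next nb , prev nb , next≢prev nb ,
         (to-next nb , x≢X , ≢anchor (to-next nb)) , (to-prev nb , x≢X , ≢anchor (to-prev nb))
      where
      ≢anchor : ∀ {p} → EdgeOf (ω X) x p → p ≢ X
      ≢anchor e refl = ¬Xx (Adj-sym (edge⇒Adj e))

    anchor-edge : ∀ {x} → x ∈ ω X → Adj G X x → EdgeOf (ω X) X x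
    anchor-edge {x} x∈ Xx with neighbours anchor∈
    ... | nb with x ≟ᶠ next nb | x ≟ᶠ prev nb
    ...   | yes refl | _        = to-next nb
    ...   | no _     | yes refl = to-prev nb
    ...   | no x≢next | no x≢prev = ⊥-elim (¬three-anchor-neighbours
              x∈ (proj₂ (EdgeOf-∈ _ (to-next nb))) (proj₂ (EdgeOf-∈ _ (to-prev nb)))
              Xx (edge⇒Adj (to-next nb)) (edge⇒Adj (to-prev nb)) x≢next x≢prev (next≢prev nb))

  SubDel-if-EDel⊆ : ∀ {X Y} → X ∉ C → (∀ x z → EDel (ω X) X x z → EDel (ω Y) Y x z) →
    SubDel (ω X) X (ω Y) Y
  SubDel-if-EDel⊆ {X} {Y} X∉ edges⊆ = vertices⊆ , edges⊆
    where
    vertices⊆ : ∀ x → VDel (ω X) X x → VDel (ω Y) Y x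
    vertices⊆ x x∈ =
      let (p , d) = Wedge.VDel⇒EDel X∉ x∈
          (e , x≢Y , _) = edges⊆ x p d
      in proj₁ (EdgeOf-∈ (ω Y) e) , x≢Y

  -- An internal vertex of ω(X) − X would keep its two path neighbours inside ω(Y),
  -- where x already has the neighbour Y.
  Adj-if-SubDel : ∀ {X Y x} → X ∉ C → Y ∉ C → SubDel (ω X) X (ω Y) Y →
    VDel (ω X) X x → Adj G Y x → Adj G X x
  Adj-if-SubDel {X} {Y} {x} X∉ Y∉ (vertices⊆ , edges⊆) x∈ Yx = decidable-stable (Adj? X x) λ ¬Xx →
    let (p , q , p≢q , xp , xq) = Wedge.two-EDel-if-¬Adj X∉ x∈ ¬Xx
        (x∈ωY , _) = vertices⊆ x x∈
        (xp′ , _ , p≢Y) = edges⊆ x p xp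
        (xq′ , _ , q≢Y) = edges⊆ x q xq
        xY = EdgeOf-sym (ω Y) (Wedge.anchor-edge Y∉ x∈ωY Yx)
        only-Y = only (Wedge.neighbours Y∉ x∈ωY)
    in three-among-two (only-Y xp′) (only-Y xq′) (only-Y xY) p≢q p≢Y q≢Y

  ¬SubDel-into-attached : ∀ {X Y} → X ∉ C → Y ∉ C → X ≢ Y → Attaches G Y (ω X) →
    ¬ SubDel (ω X) X (ω Y) Y
  ¬SubDel-into-attached {X} {Y} X∉ Y∉ X≢Y (_ , N[Y]⊆ωX) sub =
    let (z , Yz , ¬Xz) = I-incomparable Y X Y∉ X∉ (X≢Y ∘ sym)
        z∈ωX−X = N[Y]⊆ωX z Yz , ∉C⇒≢ X∉ (neighbour∈C Y∉ Yz)
    in ¬Xz (Adj-if-SubDel X∉ Y∉ sub z∈ωX−X Yz)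

  module CutAt {y : Fin n} {A B : List (Fin n)} (C≡ : C ≡ A ++ y ∷ B) where

    open Walk y (B ++ A) public

    rotation : C ↭ y ∷ B ++ A
    rotation = subst (_↭ y ∷ B ++ A) (sym C≡) (++-comm A (y ∷ B))

    cut-unique : Unique (y ∷ B ++ A)
    cut-unique = SetoidPermutation.Unique-resp-↭ (setoid (Fin n)) (↭⇒↭ₛ rotation) C-unique

    vertex∈C : ∀ {j} → j ≤ len → vertex j ∈ C
    vertex∈C j≤len = ∈-resp-↭ (↭-sym rotation) (vertex-∈ j≤len)

    vertex-distinct : ∀ {i j} → i < j → j < len → vertex i ≢ vertex j
    vertex-distinct i<j j<len eq =
      <-irrefl (vertex-injective cut-unique (<-trans i<j j<len) j<len eq) i<j

    EdgeOfC⇒cut : ∀ {a b} → EdgeOf C a b → EdgeOf (y ∷ B ++ A) a b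
    EdgeOfC⇒cut = EdgeOf-rotate A B y ∘ subst (λ W → EdgeOf W _ _) C≡

    EdgeAt : Fin n → ℕ → Set
    EdgeAt X j = EDel (ω X) X (vertex j) (vertex (suc j))

    EdgeAt? : ∀ X → Decidable (EdgeAt X)
    EdgeAt? X j = EDel? (ω X) X (vertex j) (vertex (suc j))

    EDel⊆-if-EdgeAt⊆ : ∀ {X Y} → X ∉ C → (∀ {j} → j < len → EdgeAt X j → EdgeAt Y j) →
      ∀ x z → EDel (ω X) X x z → EDel (ω Y) Y x z
    EDel⊆-if-EdgeAt⊆ X∉ at⊆ x z d with EdgeOfC⇒cut (Wedge.EDel⇒EdgeOfC X∉ d)
    ... | inj₁ p with edge⇒position p
    ...   | j , j<len , refl , refl = at⊆ j<len d
    EDel⊆-if-EdgeAt⊆ X∉ at⊆ x z d | inj₂ p with edge⇒position p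
    ...   | j , j<len , refl , refl = EDel-sym (ω _) (at⊆ j<len (EDel-sym (ω _) d))

    EDel-at-vertex : ∀ {X k p} → X ∉ C → suc k < len → EDel (ω X) X (vertex (suc k)) p →
      p ≡ vertex (suc (suc k)) ⊎ p ≡ vertex k
    EDel-at-vertex X∉ sk<len d =
      edge-from-vertex cut-unique sk<len (EdgeOfC⇒cut (Wedge.EDel⇒EdgeOfC X∉ d))

    Flips⇒VDel : ∀ {X k} → Flips (EdgeAt X) k → VDel (ω X) X (vertex (suc k))
    Flips⇒VDel (inj₁ ((e , _ , v≢X) , _)) = proj₂ (EdgeOf-∈ _ e) , v≢X
    Flips⇒VDel (inj₂ (_ , (e , v≢X , _))) = proj₁ (EdgeOf-∈ _ e) , v≢X

    Flips⇒Adj : ∀ {X k} → X ∉ C → suc k < len → Flips (EdgeAt X) k → Adj G X (vertex (suc k))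
    Flips⇒Adj {X} {k} X∉ sk<len flip = decidable-stable (Adj? X _) λ ¬Xv →
      let (p , q , p≢q , dp , dq) = Wedge.two-EDel-if-¬Adj X∉ (Flips⇒VDel flip) ¬Xv
      in at-both-sides dp dq p≢q (EDel-at-vertex X∉ sk<len dp) (EDel-at-vertex X∉ sk<len dq)
      where
      at-both-sides : ∀ {p q} →
        EDel (ω X) X (vertex (suc k)) p → EDel (ω X) X (vertex (suc k)) q → p ≢ q →
        p ≡ vertex (suc (suc k)) ⊎ p ≡ vertex k → q ≡ vertex (suc (suc k)) ⊎ q ≡ vertex k → ⊥
      at-both-sides _  _  p≢q (inj₁ refl) (inj₁ refl) = p≢q refl
      at-both-sides _  _  p≢q (inj₂ refl) (inj₂ refl) = p≢q refl
      at-both-sides dp dq _   (inj₁ refl) (inj₂ refl) = ¬Flips-both {EdgeAt X} flip (EDel-sym (ω X) dq) dp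
      at-both-sides dp dq _   (inj₂ refl) (inj₁ refl) = ¬Flips-both {EdgeAt X} flip (EDel-sym (ω X) dp) dq

  SubDel-if-missed-neighbour : ∀ {u v y} → u ∉ C → v ∉ C → Attaches G u (ω v) →
    Adj G v y → y ∉ ω u → SubDel (ω u) u (ω v) v
  SubDel-if-missed-neighbour {u} {v} {y} u∉ v∉ (_ , N[u]⊆ωv) vy y∉ωu
    with ∈-∃++ (neighbour∈C v∉ vy)
  ... | A , B , C≡ = SubDel-if-EDel⊆ u∉ (EDel⊆-if-EdgeAt⊆ u∉ EdgeAt⊆)
    where
    open CutAt C≡

    AnchorNeighbourAt : ℕ → Set
    AnchorNeighbourAt r = Adj G v (vertex r) × vertex r ∈ ω v

    flip⇒neighbour : ∀ {k} → k < length (B ++ A) → Flips (EdgeAt v) k → AnchorNeighbourAt (suc k)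
    flip⇒neighbour k<last flip = Flips⇒Adj v∉ (s≤s k<last) flip , proj₁ (Flips⇒VDel flip)

    start⇒neighbour : EdgeAt v 0 → AnchorNeighbourAt 0
    start⇒neighbour (e , _) = vy , proj₁ (EdgeOf-∈ _ e)

    neighbours-atMost2 : ∀ {i j k} → i < j → j < k → k ≤ length (B ++ A) →
      AnchorNeighbourAt i → AnchorNeighbourAt j → AnchorNeighbourAt k → ⊥
    neighbours-atMost2 i<j j<k k≤last (vi , i∈) (vj , j∈) (vk , k∈) =
      Wedge.¬three-anchor-neighbours v∉ i∈ j∈ k∈ vi vj vk
        (vertex-distinct i<j (<-trans j<k (s≤s k≤last)))
        (vertex-distinct (<-trans i<j j<k) (s≤s k≤last))
        (vertex-distinct j<k (s≤s k≤last))

    open Interval (length (B ++ A)) (EdgeAt? v) flip⇒neighbour start⇒neighbour neighbours-atMost2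

    flip⇒touch : ∀ {k} → k < length (B ++ A) → Flips (EdgeAt u) k → EdgeAt v k ⊎ EdgeAt v (suc k)
    flip⇒touch k<last flip
      with Wedge.VDel⇒EDel v∉ ( N[u]⊆ωv _ (Flips⇒Adj u∉ (s≤s k<last) flip)
                               , ∉C⇒≢ v∉ (vertex∈C (<⇒≤ (s≤s k<last))))
    ... | p , d with EDel-at-vertex v∉ (s≤s k<last) d
    ...   | inj₁ refl = inj₂ d
    ...   | inj₂ refl = inj₁ (EDel-sym (ω v) d)

    EdgeAt⊆ : ∀ {j} → j < len → EdgeAt u j → EdgeAt v j
    EdgeAt⊆ j<len = contained (EdgeAt? u)
      (λ (e , _) → y∉ωu (proj₁ (EdgeOf-∈ _ e)))
      (λ (e , _) → y∉ωu (subst (_∈ ω u) vertex-len (proj₂ (EdgeOf-∈ _ e))))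
      flip⇒touch (≤-pred j<len)

lemma4p2 : (n : ℕ) (G : Graph n) (C : List (Fin n)) → IsCobweb G C →
    (ω : Fin n → List (Fin n)) → WedgeSelection G C ω →
    (u v : Fin n) → u ∉ C → v ∉ C → u ≢ v →
    Attaches G u (ω v) →
    ExactlyOne (Improves ω u v) (Attaches G v (ω u))
lemma4p2 n G C cob ω ws u v u∉ v∉ u≢v att = by-cases (SubDel? (ω u) u (ω v) v)
  where
  open Cobweb G C cob ω ws
  open DecMembership (_≟ᶠ_ {n}) using (_∈?_)

  by-cases : Dec (SubDel (ω u) u (ω v) v) → ExactlyOne (Improves ω u v) (Attaches G v (ω u))
  by-cases (yes sub) =
    inj₁ (sub , ¬SubDel-into-attached v∉ u∉ (u≢v ∘ sym) att) ,
    λ (improves , v-attaches) → ¬SubDel-into-attached u∉ v∉ u≢v v-attaches (proj₁ improves)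
  by-cases (no ¬sub) = inj₂ v-attaches , λ (improves , _) → ¬sub (proj₁ improves)
    where
    v-attaches : Attaches G v (ω u)
    v-attaches =
      (λ v∈ → u≢v (sym (Wedge.only-anchor u∉ v v∈ v∉))) ,
      (λ x vx → decidable-stable (x ∈? ω u) (¬sub ∘ SubDel-if-missed-neighbour u∉ v∉ att vx))
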